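{- Let $a,b,c$ be positive integers such that $Q^{abc}=1+x^a(x+1)^b(1+x+x^2)^c$ is irreducible over $\mathbb{F}_2$, suppose $(Q^{abc})^*=Q^{def}\neq Q^{abc}$ for some positive integers $d,e,f$, and suppose $a+b+2c=3\cdot 2^n$ for some nonnegative integer $n$. If $b>2^n$, then $a=1$, $e=2^n$, $b=2^n+1$, $f=c=2^n-1$ and $d=2$.
   Context: Here $Q=1+x+x^2$, $Q^{def}:=1+x^d(x+1)^eQ^f$, and $P^*(x):=x^{\deg P}P(1/x)$ is the reciprocal of $P\in\mathbb{F}_2[x]$; thus $(Q^{abc})^*=x^{a+b+2c}+(x+1)^b(x^2+x+1)^c$. -}

module Defs where

open import Data.Bool using (Bool; true; false; _xor_; _∧_)
open import Data.List using (List; []; _∷_; reverse)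
open import Data.Nat using (ℕ; zero; suc)
open import Data.Product using (Σ)
open import Data.Sum using (_⊎_)
open import Relation.Binary.PropositionalEquality using (_≡_)
open import Relation.Nullary using (¬_)

-- Polynomials over F₂ = Bool (true = 1, xor = +, ∧ = ·),
-- as little-endian coefficient lists (trailing zeros allowed).
Poly : Set
Poly = List Bool

coeff : Poly → ℕ → Bool
coeff []      _       = false
coeff (a ∷ p) zero    = a
coeff (a ∷ p) (suc i) = coeff p i

infix 4 _≈_
_≈_ : Poly → Poly → Set
p ≈ q = ∀ i → coeff p i ≡ coeff q i

infixl 6 _+_
_+_ : Poly → Poly → Poly
[]      + q       = q
(a ∷ p) + []      = a ∷ p
(a ∷ p) + (b ∷ q) = (a xor b) ∷ (p + q)

scale : Bool → Poly → Poly
scale a []      = []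
scale a (b ∷ q) = (a ∧ b) ∷ scale a q

infixl 7 _*_
_*_ : Poly → Poly → Poly
[]      * q = []
(a ∷ p) * q = scale a q + (false ∷ (p * q))

one : Poly
one = true ∷ []

X : Poly
X = false ∷ true ∷ []

infixr 8 _^_
_^_ : Poly → ℕ → Poly
p ^ zero  = one
p ^ suc n = p * (p ^ n)

Q : Poly
Q = true ∷ true ∷ true ∷ []

Qabc : ℕ → ℕ → ℕ → Poly
Qabc a b c = one + (X ^ a) * ((X + one) ^ b) * (Q ^ c)

normalize : Poly → Poly
normalize []      = []
normalize (a ∷ p) with normalize p
... | []     = if' a
  where
    if' : Bool → Poly
    if' true  = true ∷ []
    if' false = []
... | r ∷ rs = a ∷ r ∷ rs

-- reciprocal P*(x) = x^{deg P} P(1/x)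
reciprocal : Poly → Poly
reciprocal p = reverse (normalize p)

IsUnit : Poly → Set
IsUnit u = Σ Poly (λ v → u * v ≈ one)

record Irreducible (p : Poly) : Set where
  field
    nonzero  : ¬ (p ≈ [])
    nonunit  : ¬ IsUnit p
    factors  : ∀ g h → p ≈ g * h → IsUnit g ⊎ IsUnit h

module Submission where

-- Put t = 2ⁿ.  We have (Q^{abc})* = x^{3t} + (x+1)^b Q^c, and by Frobenius
-- x^{3t} + 1 = ((x+1)Q)^t.  Writing b = t + k and t = c + m (so k, m ≥ 1 and
-- a + k = 2m) this gives  x^d (x+1)^e Q^f = (x+1)^t Q^c (Q^m + (x+1)^k).
-- Comparing the multiplicities of the roots 1 of x + 1 and ω ∈ F₄ of Q gives
-- e = t and f = c; cancelling, x^d = Q^m + (x+1)^k, and comparing degrees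
-- (k < 2m) gives d = 2m.  Differentiating kills x^{2m} and shows m = k = 1 unless
-- m and k are both even; then a, b, c are even and Q^{abc} is a square,
-- contradicting irreducibility.

open import Defs
open import Data.Nat using (ℕ; _≤_; _<_) renaming (_+_ to _+ℕ_; _*_ to _*ℕ_; _^_ to _^ℕ_; _∸_ to _∸ℕ_)
open import Data.Product using (_×_)
open import Relation.Binary.PropositionalEquality using (_≡_)
open import Relation.Nullary using (¬_)

open import Data.Bool using (Bool; true; false; not; _xor_; _∧_)
open import Data.Bool.Properties
  using (xor-comm; xor-assoc; xor-identityʳ; xor-same; ∧-zeroʳ; ∧-comm; ∧-distribˡ-xor; ∧-distribʳ-xor)
  renaming (_≟_ to _≟ᵇ_; xor-∧-commutativeRing to 𝔽₂)
open import Data.List using ([]; _∷_; _∷ʳ_; reverse; length)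
open import Data.List.Properties using (unfold-reverse)
open import Data.Nat using (zero; suc; z≤n; s≤s)
import Data.Nat.Properties as ℕₚ
open import Data.Nat.Tactic.RingSolver using (solve-∀)
open import Data.Product using (_,_; ∃-syntax; proj₁; proj₂)
open import Data.Nat.Divisibility using (_∣_; divides; n∣m*n; ∣m∣n⇒∣m+n; ∣m+n∣m⇒∣n)
open import Data.Sum using (_⊎_; inj₁; inj₂; [_,_]′)
open import Data.Empty using (⊥; ⊥-elim)
open import Data.Maybe using (Maybe; just; nothing)
open import Data.Fin using (Fin; zero; suc) renaming (_≟_ to _≟ᶠ_)
open import Data.Fin.Properties using (all?)
open import Relation.Nullary.Decidable using (from-yes; _→-dec_; _⊎-dec_)
open import Relation.Nullary using (yes; no; contradiction)
open import Relation.Binary.Definitions using (tri<; tri≈; tri>)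
open import Relation.Binary.PropositionalEquality using (refl; sym; trans; cong; cong₂; subst; subst₂)
open import Relation.Binary.Structures using (IsEquivalence)
open import Relation.Binary.Bundles using (Setoid)
open import Algebra.Bundles using (CommutativeRing)
open import Algebra.Solver.Ring.AlmostCommutativeRing using (fromCommutativeRing; _-Raw-AlmostCommutative⟶_)
import Algebra.Solver.Ring
import Algebra.Properties.CommutativeSemiring.Exp

-- Coefficientwise equality, wrapped in a record so that the compared
-- polynomials can be inferred from a proof.
infix 4 _≋_
record _≋_ (p q : Poly) : Set where
  constructor ≈⇒≋
  field ≋⇒≈ : p ≈ q
open _≋_

≋-refl : ∀ {p} → p ≋ p
≋-refl = ≈⇒≋ λ _ → refl

≋-sym : ∀ {p q} → p ≋ q → q ≋ p
≋-sym (≈⇒≋ e) = ≈⇒≋ λ i → sym (e i)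

≋-trans : ∀ {p q r} → p ≋ q → q ≋ r → p ≋ r
≋-trans (≈⇒≋ e) (≈⇒≋ f) = ≈⇒≋ λ i → trans (e i) (f i)

≋-isEquivalence : IsEquivalence _≋_
≋-isEquivalence = record { refl = ≋-refl ; sym = ≋-sym ; trans = ≋-trans }

≋-setoid : Setoid _ _
≋-setoid = record { isEquivalence = ≋-isEquivalence }

open import Relation.Binary.Reasoning.Setoid ≋-setoid

∷-cong : ∀ {a b p q} → a ≡ b → p ≋ q → a ∷ p ≋ b ∷ q
∷-cong a≡b (≈⇒≋ e) = ≈⇒≋ λ { zero → a≡b ; (suc i) → e i }

coeff-+ : ∀ p q i → coeff (p + q) i ≡ coeff p i xor coeff q i
coeff-+ []      q       i       = refl
coeff-+ (a ∷ p) []      i       = sym (xor-identityʳ _)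
coeff-+ (a ∷ p) (b ∷ q) zero    = refl
coeff-+ (a ∷ p) (b ∷ q) (suc i) = coeff-+ p q i

coeff-scale : ∀ a p i → coeff (scale a p) i ≡ a ∧ coeff p i
coeff-scale a []      i       = sym (∧-zeroʳ a)
coeff-scale a (b ∷ p) zero    = refl
coeff-scale a (b ∷ p) (suc i) = coeff-scale a p i

+-cong : ∀ {p p' q q'} → p ≋ p' → q ≋ q' → p + q ≋ p' + q'
+-cong {p} {p'} {q} {q'} (≈⇒≋ e) (≈⇒≋ f) = ≈⇒≋ λ i →
  trans (coeff-+ p q i) (trans (cong₂ _xor_ (e i) (f i)) (sym (coeff-+ p' q' i)))

+-comm : ∀ p q → p + q ≋ q + p
+-comm p q = ≈⇒≋ λ i →
  trans (coeff-+ p q i) (trans (xor-comm (coeff p i) (coeff q i)) (sym (coeff-+ q p i)))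

+-assoc : ∀ p q r → (p + q) + r ≋ p + (q + r)
+-assoc p q r = ≈⇒≋ λ i →
  trans (expand p q r i) (trans (xor-assoc (coeff p i) (coeff q i) (coeff r i)) (sym (expand' p q r i)))
  where
  expand : ∀ p q r i → coeff ((p + q) + r) i ≡ (coeff p i xor coeff q i) xor coeff r i
  expand p q r i = trans (coeff-+ (p + q) r i) (cong (_xor coeff r i) (coeff-+ p q i))
  expand' : ∀ p q r i → coeff (p + (q + r)) i ≡ coeff p i xor (coeff q i xor coeff r i)
  expand' p q r i = trans (coeff-+ p (q + r) i) (cong (coeff p i xor_) (coeff-+ q r i))

+-identityʳ : ∀ p → p + [] ≋ p
+-identityʳ p = ≈⇒≋ λ i → trans (coeff-+ p [] i) (xor-identityʳ _)

+-self : ∀ p → p + p ≋ []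
+-self p = ≈⇒≋ λ i → trans (coeff-+ p p i) (xor-same (coeff p i))

scale-cong : ∀ a {p q} → p ≋ q → scale a p ≋ scale a q
scale-cong a {p} {q} (≈⇒≋ e) = ≈⇒≋ λ i →
  trans (coeff-scale a p i) (trans (cong (a ∧_) (e i)) (sym (coeff-scale a q i)))

scale-xor : ∀ a b p → scale (a xor b) p ≋ scale a p + scale b p
scale-xor a b p = ≈⇒≋ λ i → trans (coeff-scale (a xor b) p i) (trans (∧-distribʳ-xor (coeff p i) a b)
  (sym (trans (coeff-+ (scale a p) (scale b p) i) (cong₂ _xor_ (coeff-scale a p i) (coeff-scale b p i)))))

scale-true : ∀ p → scale true p ≋ p
scale-true p = ≈⇒≋ (coeff-scale true p)

scale-false : ∀ p → scale false p ≋ []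
scale-false p = ≈⇒≋ (coeff-scale false p)

-- Two rearrangements of sums, needed before the ring solver is available.
+-left-comm : ∀ p q r → p + (q + r) ≋ q + (p + r)
+-left-comm p q r = ≋-trans (≋-sym (+-assoc p q r)) (≋-trans (+-cong (+-comm p q) (≋-refl {r})) (+-assoc q p r))

+-interchange : ∀ p q r s → (p + q) + (r + s) ≋ (p + r) + (q + s)
+-interchange p q r s = ≋-trans (+-assoc p q (r + s))
  (≋-trans (+-cong (≋-refl {p}) (+-left-comm q r s)) (≋-sym (+-assoc p r (q + s))))

false∷[]≋[] : false ∷ [] ≋ []
false∷[]≋[] = ≈⇒≋ λ { zero → refl ; (suc i) → refl }

*-zeroʳ : ∀ p → p * [] ≋ []
*-zeroʳ []      = ≋-refl
*-zeroʳ (a ∷ p) = ≋-trans (∷-cong refl (*-zeroʳ p)) false∷[]≋[]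

*-consʳ : ∀ p b q → p * (b ∷ q) ≋ scale b p + (false ∷ p * q)
*-consʳ []      b q = ≋-sym false∷[]≋[]
*-consʳ (a ∷ p) b q = ∷-cong (cong (_xor false) (∧-comm a b))
  (≋-trans (+-cong ≋-refl (*-consʳ p b q)) (+-left-comm (scale a q) (scale b p) (false ∷ p * q)))

*-comm : ∀ p q → p * q ≋ q * p
*-comm []      q = ≋-sym (*-zeroʳ q)
*-comm (a ∷ p) q = ≋-trans (+-cong ≋-refl (∷-cong refl (*-comm p q))) (≋-sym (*-consʳ q a p))

*-congʳ : ∀ p {q q'} → q ≋ q' → p * q ≋ p * q'
*-congʳ []      e = ≋-refl
*-congʳ (a ∷ p) e = +-cong (scale-cong a e) (∷-cong refl (*-congʳ p e))

*-cong : ∀ {p p' q q'} → p ≋ p' → q ≋ q' → p * q ≋ p' * q'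
*-cong {p} {p'} {q} {q'} e f = begin
  p * q   ≈⟨ *-congʳ p f ⟩
  p * q'  ≈⟨ *-comm p q' ⟩
  q' * p  ≈⟨ *-congʳ q' e ⟩
  q' * p' ≈⟨ *-comm q' p' ⟩
  p' * q' ∎

*-shiftˡ : ∀ s r → (false ∷ s) * r ≋ false ∷ s * r
*-shiftˡ s r = +-cong (scale-false r) ≋-refl

*-distribʳ : ∀ p q r → (p + q) * r ≋ p * r + q * r
*-distribʳ []      q       r = ≋-refl
*-distribʳ (a ∷ p) []      r = ≋-sym (+-identityʳ _)
*-distribʳ (a ∷ p) (b ∷ q) r =
  ≋-trans (+-cong (scale-xor a b r) (∷-cong refl (*-distribʳ p q r)))
          (+-interchange (scale a r) (scale b r) (false ∷ p * r) (false ∷ q * r))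

scale-* : ∀ a q r → scale a q * r ≋ scale a (q * r)
scale-* true  q r = ≋-trans (*-cong (scale-true q) ≋-refl) (≋-sym (scale-true (q * r)))
scale-* false q r = ≋-trans (*-cong (scale-false q) ≋-refl) (≋-sym (scale-false (q * r)))

*-assoc : ∀ p q r → (p * q) * r ≋ p * (q * r)
*-assoc []      q r = ≋-refl
*-assoc (a ∷ p) q r = ≋-trans (*-distribʳ (scale a q) (false ∷ p * q) r)
  (+-cong (scale-* a q r) (≋-trans (*-shiftˡ (p * q) r) (∷-cong refl (*-assoc p q r))))

*-identityˡ : ∀ p → one * p ≋ p
*-identityˡ p = ≋-trans (+-cong (scale-true p) false∷[]≋[]) (+-identityʳ p)

*-identityʳ : ∀ p → p * one ≋ p
*-identityʳ p = ≋-trans (*-comm p one) (*-identityˡ p)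

-- F₂[x] is a commutative ring (of characteristic 2: negation is the identity).
F₂[x] : CommutativeRing _ _
F₂[x] = record
  { Carrier = Poly ; _≈_ = _≋_ ; _+_ = _+_ ; _*_ = _*_ ; -_ = λ p → p ; 0# = [] ; 1# = one
  ; isCommutativeRing = record
    { isRing = record
      { +-isAbelianGroup = record
        { isGroup = record
          { isMonoid = record
            { isSemigroup = record
              { isMagma = record { isEquivalence = ≋-isEquivalence ; ∙-cong = +-cong }
              ; assoc = +-assoc }
            ; identity = (λ p → ≋-refl) , +-identityʳ }
          ; inverse = +-self , +-self
          ; ⁻¹-cong = λ e → e }
        ; comm = +-comm }
      ; *-cong = *-cong
      ; *-assoc = *-assoc
      ; *-identity = *-identityˡ , *-identityʳ
      ; distrib = (λ p q r → ≋-trans (*-comm p (q + r)) (≋-trans (*-distribʳ q r p) (+-cong (*-comm q p) (*-comm r p))))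
                , (λ p q r → *-distribʳ q r p) }
    ; *-comm = *-comm } }

-- A normaliser for commutative-ring identities in F₂[x], with coefficients
-- in F₂ (so that 1 + 1 = 0 is taken into account).
constant : Bool → Poly
constant a = a ∷ []

module Solver where
  constant-homomorphism : CommutativeRing.rawRing 𝔽₂ -Raw-AlmostCommutative⟶ fromCommutativeRing F₂[x]
  constant-homomorphism = record
    { ⟦_⟧    = constant
    ; +-homo = λ a b → ≋-refl
    ; *-homo = λ a b → ∷-cong (sym (xor-identityʳ (a ∧ b))) ≋-refl
    ; -‿homo = λ a → ≋-refl
    ; 0-homo = false∷[]≋[]
    ; 1-homo = ≋-refl }

  constant-equality? : ∀ a b → Maybe (constant a ≋ constant b)
  constant-equality? a b with a ≟ᵇ b
  ... | yes refl = just ≋-refl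
  ... | no _     = nothing

  open Algebra.Solver.Ring _ _ constant-homomorphism constant-equality? public
open Solver using (solve; _:+_; _:*_; _:=_; con)

+≋[]⇒≋ : ∀ {p q} → p + q ≋ [] → p ≋ q
+≋[]⇒≋ {p} {q} e = ≋-trans (solve 2 (λ p q → p := (p :+ q) :+ q) ≋-refl p q) (+-cong e ≋-refl)

-- F₂[x] is an integral domain: if the constant term of the first factor is 1,
-- the lowest nonzero coefficient of q survives in the product.
unit-constant-no-zero-divisor : ∀ p q → (true ∷ p) * q ≋ [] → q ≋ []
unit-constant-no-zero-divisor p []          _ = ≋-refl
unit-constant-no-zero-divisor p (true ∷ q)  (≈⇒≋ e) with e zero
... | ()
unit-constant-no-zero-divisor p (false ∷ q) e =
  ≋-trans (∷-cong refl (unit-constant-no-zero-divisor p q tail≋[])) false∷[]≋[]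
  where
  shifted : scale false (true ∷ p) + (false ∷ (true ∷ p) * q) ≋ []
  shifted = ≋-trans (≋-sym (*-consʳ (true ∷ p) false q)) e
  tail≋[] : (true ∷ p) * q ≋ []
  tail≋[] = ≋-trans (≋-sym (+-cong (scale-false p) ≋-refl)) (≈⇒≋ λ i → ≋⇒≈ shifted (suc i))

no-zero-divisors : ∀ p q → p * q ≋ [] → p ≋ [] ⊎ q ≋ []
no-zero-divisors []          q e = inj₁ ≋-refl
no-zero-divisors (true ∷ p)  q e = inj₂ (unit-constant-no-zero-divisor p q e)
no-zero-divisors (false ∷ p) q e
  with no-zero-divisors p q (≈⇒≋ λ i → ≋⇒≈ (≋-trans (≋-sym (*-shiftˡ p q)) e) (suc i))
... | inj₁ p≋[] = inj₁ (≋-trans (∷-cong refl p≋[]) false∷[]≋[])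
... | inj₂ q≋[] = inj₂ q≋[]

*-cancelˡ : ∀ c {u v} → ¬ c ≋ [] → c * u ≋ c * v → u ≋ v
*-cancelˡ c {u} {v} c≢0 cu≋cv = [ (λ c≋[] → ⊥-elim (c≢0 c≋[])) , +≋[]⇒≋ ]′ (no-zero-divisors c (u + v) c[u+v]≋[])
  where
  c[u+v]≋[] : c * (u + v) ≋ []
  c[u+v]≋[] = begin
    c * (u + v)   ≈⟨ solve 3 (λ c u v → c :* (u :+ v) := c :* u :+ c :* v) ≋-refl c u v ⟩
    c * u + c * v ≈⟨ +-cong cu≋cv ≋-refl ⟩
    c * v + c * v ≈⟨ +-self (c * v) ⟩
    []            ∎

-- Powers.  Defs' p ^ n agrees with the library's repeated product in the ring
-- F₂[x], so the library's exponent laws transfer.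
module LibraryPowers = Algebra.Properties.CommutativeSemiring.Exp (CommutativeRing.commutativeSemiring F₂[x])
open LibraryPowers using () renaming (_^_ to _^ᴸ_)

^≋^ᴸ : ∀ p n → p ^ n ≋ p ^ᴸ n
^≋^ᴸ p zero    = ≋-refl
^≋^ᴸ p (suc n) = *-cong (≋-refl {p}) (^≋^ᴸ p n)

^-cong : ∀ {p q} n → p ≋ q → p ^ n ≋ q ^ n
^-cong n e = ≋-trans (^≋^ᴸ _ n) (≋-trans (LibraryPowers.^-congˡ n e) (≋-sym (^≋^ᴸ _ n)))

^-+ : ∀ p i j → p ^ (i +ℕ j) ≋ p ^ i * p ^ j
^-+ p i j = ≋-trans (^≋^ᴸ p (i +ℕ j)) (≋-trans (LibraryPowers.^-homo-* p i j)
  (≋-sym (*-cong (^≋^ᴸ p i) (^≋^ᴸ p j))))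

^-* : ∀ p i j → p ^ (i *ℕ j) ≋ (p ^ i) ^ j
^-* p i j = ≋-trans (^≋^ᴸ p (i *ℕ j)) (≋-trans (≋-sym (LibraryPowers.^-assocʳ p i j))
  (≋-sym (≋-trans (^≋^ᴸ (p ^ i) j) (LibraryPowers.^-congˡ j (^≋^ᴸ p i)))))

*-^ : ∀ p q n → (p * q) ^ n ≋ p ^ n * q ^ n
*-^ p q n = ≋-trans (^≋^ᴸ (p * q) n) (≋-trans (LibraryPowers.^-distrib-* p q n)
  (≋-sym (*-cong (^≋^ᴸ p n) (^≋^ᴸ q n))))

one-^ : ∀ n → one ^ n ≋ one
one-^ zero    = ≋-refl
one-^ (suc n) = ≋-trans (*-identityˡ (one ^ n)) (one-^ n)

frobenius : ∀ p q n → (p + q) ^ (2 ^ℕ n) ≋ p ^ (2 ^ℕ n) + q ^ (2 ^ℕ n)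
frobenius p q zero    = solve 2 (λ p q → (p :+ q) :* con true := p :* con true :+ q :* con true) ≋-refl p q
frobenius p q (suc n) = begin
  (p + q) ^ (2 *ℕ N)                 ≈⟨ ^-* (p + q) 2 N ⟩
  ((p + q) ^ 2) ^ N                  ≈⟨ ^-cong N (solve 2 (λ p q → (p :+ q) :* ((p :+ q) :* con true)
                                          := p :* (p :* con true) :+ q :* (q :* con true)) ≋-refl p q) ⟩
  (p ^ 2 + q ^ 2) ^ N                ≈⟨ frobenius (p ^ 2) (q ^ 2) n ⟩
  (p ^ 2) ^ N + (q ^ 2) ^ N          ≈⟨ ≋-sym (+-cong (^-* p 2 N) (^-* q 2 N)) ⟩
  p ^ (2 *ℕ N) + q ^ (2 *ℕ N)        ∎
  where
  N : ℕ
  N = 2 ^ℕ n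

Deg≤ : Poly → ℕ → Set
Deg≤ p D = ∀ i → D < i → coeff p i ≡ false

deg≤-tail : ∀ {a p D} → Deg≤ (a ∷ p) (suc D) → Deg≤ p D
deg≤-tail h i D<i = h (suc i) (s≤s D<i)

deg≤0-tail : ∀ {a p} → Deg≤ (a ∷ p) 0 → p ≋ []
deg≤0-tail h = ≈⇒≋ λ i → h (suc i) (s≤s z≤n)

deg≤-one : Deg≤ one 0
deg≤-one (suc i) _ = refl

coeff-∷-* : ∀ a p q i → coeff ((a ∷ p) * q) i ≡ (a ∧ coeff q i) xor coeff (false ∷ p * q) i
coeff-∷-* a p q i = trans (coeff-+ (scale a q) (false ∷ p * q) i) (cong (_xor _) (coeff-scale a q i))

coeff-shifted-zero : ∀ {p} q → p ≋ [] → ∀ i → coeff (false ∷ p * q) i ≡ false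
coeff-shifted-zero q p≋[] zero    = refl
coeff-shifted-zero q p≋[] (suc i) = ≋⇒≈ (*-cong p≋[] (≋-refl {q})) i

deg≤-* : ∀ p q m n → Deg≤ p m → Deg≤ q n → Deg≤ (p * q) (m +ℕ n)
deg≤-* []      q m       n hp hq i       _     = refl
deg≤-* (a ∷ p) q m       n hp hq zero    ()
deg≤-* (a ∷ p) q m       n hp hq (suc i) m+n<i = trans (coeff-∷-* a p q (suc i))
  (cong₂ _xor_ (trans (cong (a ∧_) (hq (suc i) (ℕₚ.≤-<-trans (ℕₚ.m≤n+m n m) m+n<i))) (∧-zeroʳ a)) (tail m hp m+n<i))
  where
  tail : ∀ m → Deg≤ (a ∷ p) m → m +ℕ n < suc i → coeff (false ∷ p * q) (suc i) ≡ false
  tail zero    hp _           = coeff-shifted-zero q (deg≤0-tail hp) (suc i)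
  tail (suc m) hp (s≤s m+n<i) = deg≤-* p q m n (deg≤-tail hp) hq i m+n<i

coeff-top-* : ∀ p q m n → Deg≤ p m → Deg≤ q n → coeff (p * q) (m +ℕ n) ≡ coeff p m ∧ coeff q n
coeff-top-* []      q m       n hp hq = refl
coeff-top-* (a ∷ p) q zero    n hp hq = trans (coeff-∷-* a p q n)
  (trans (cong ((a ∧ coeff q n) xor_) (coeff-shifted-zero q (deg≤0-tail hp) n)) (xor-identityʳ _))
coeff-top-* (a ∷ p) q (suc m) n hp hq = trans (coeff-∷-* a p q (suc (m +ℕ n)))
  (cong₂ _xor_ (trans (cong (a ∧_) (hq (suc (m +ℕ n)) (s≤s (ℕₚ.m≤n+m n m)))) (∧-zeroʳ a)) (coeff-top-* p q m n (deg≤-tail hp) hq))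

deg≤-^ : ∀ p D k → Deg≤ p D → Deg≤ (p ^ k) (k *ℕ D)
deg≤-^ p D zero    h = deg≤-one
deg≤-^ p D (suc k) h = deg≤-* p (p ^ k) D (k *ℕ D) h (deg≤-^ p D k h)

coeff-top-^ : ∀ p D k → Deg≤ p D → coeff p D ≡ true → coeff (p ^ k) (k *ℕ D) ≡ true
coeff-top-^ p D zero    h top = refl
coeff-top-^ p D (suc k) h top = trans (coeff-top-* p (p ^ k) D (k *ℕ D) h (deg≤-^ p D k h)) (cong₂ _∧_ top (coeff-top-^ p D k h top))

X*-shift : ∀ s → X * s ≋ false ∷ s
X*-shift s = ≋-trans (*-shiftˡ one s) (∷-cong refl (*-identityˡ s))

constant-* : ∀ a s → constant a * s ≋ scale a s
constant-* a s = ≋-trans (+-cong ≋-refl false∷[]≋[]) (+-identityʳ (scale a s))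

horner : ∀ a p → a ∷ p ≋ constant a + X * p
horner a p = ≋-sym (≋-trans (+-cong (≋-refl {constant a}) (X*-shift p)) (∷-cong (xor-identityʳ a) ≋-refl))

-- The reversal of q with respect to D is x^D q(1/x), the list [q_D, …, q_0].
rev : ℕ → Poly → Poly
rev zero    q = coeff q 0 ∷ []
rev (suc D) q = coeff q (suc D) ∷ rev D q

rev-cong : ∀ D {p q} → p ≋ q → rev D p ≋ rev D q
rev-cong zero    (≈⇒≋ e) = ∷-cong (e 0) ≋-refl
rev-cong (suc D) (≈⇒≋ e) = ∷-cong (e (suc D)) (rev-cong D (≈⇒≋ e))

rev-zero : ∀ D {p} → p ≋ [] → rev D p ≋ []
rev-zero zero    (≈⇒≋ e) = ≋-trans (∷-cong (e 0) ≋-refl) false∷[]≋[]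
rev-zero (suc D) (≈⇒≋ e) = ≋-trans (∷-cong (e (suc D)) (rev-zero D (≈⇒≋ e))) false∷[]≋[]

rev-+ : ∀ D p q → rev D (p + q) ≋ rev D p + rev D q
rev-+ zero    p q = ∷-cong (coeff-+ p q 0) ≋-refl
rev-+ (suc D) p q = ∷-cong (coeff-+ p q (suc D)) (rev-+ D p q)

rev-scale : ∀ D a p → rev D (scale a p) ≋ scale a (rev D p)
rev-scale zero    a p = ∷-cong (coeff-scale a p 0) ≋-refl
rev-scale (suc D) a p = ∷-cong (coeff-scale a p (suc D)) (rev-scale D a p)

rev-shift : ∀ D w → rev (suc D) (false ∷ w) ≋ rev D w
rev-shift zero    w = ∷-cong refl false∷[]≋[]
rev-shift (suc D) w = ∷-cong refl (rev-shift D w)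

rev-raise : ∀ m n q → Deg≤ q n → rev (m +ℕ n) q ≋ X ^ m * rev n q
rev-raise zero    n q h = ≋-sym (*-identityˡ (rev n q))
rev-raise (suc m) n q h = begin
  rev (suc (m +ℕ n)) q      ≈⟨ ∷-cong (h (suc (m +ℕ n)) (s≤s (ℕₚ.m≤n+m n m))) (rev-raise m n q h) ⟩
  false ∷ X ^ m * rev n q   ≈⟨ ≋-sym (X*-shift (X ^ m * rev n q)) ⟩
  X * (X ^ m * rev n q)     ≈⟨ ≋-sym (*-assoc X (X ^ m) (rev n q)) ⟩
  X * X ^ m * rev n q       ∎

rev-* : ∀ p q m n → Deg≤ p m → Deg≤ q n → rev (m +ℕ n) (p * q) ≋ rev m p * rev n q
rev-* []      q m       n hp hq = ≋-trans (rev-zero (m +ℕ n) ≋-refl) (≋-sym (*-cong (rev-zero m ≋-refl) (≋-refl {rev n q})))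
rev-* (a ∷ p) q zero    n hp hq = begin
  rev n (scale a q + (false ∷ p * q))         ≈⟨ rev-+ n (scale a q) (false ∷ p * q) ⟩
  rev n (scale a q) + rev n (false ∷ p * q)   ≈⟨ +-cong (rev-scale n a q) (rev-zero n (≈⇒≋ (coeff-shifted-zero q (deg≤0-tail hp)))) ⟩
  scale a (rev n q) + []                      ≈⟨ +-identityʳ _ ⟩
  scale a (rev n q)                           ≈⟨ ≋-sym (constant-* a (rev n q)) ⟩
  constant a * rev n q                        ∎
rev-* (a ∷ p) q (suc m) n hp hq = begin
  rev (suc m +ℕ n) (scale a q + (false ∷ p * q))              ≈⟨ rev-+ (suc m +ℕ n) (scale a q) (false ∷ p * q) ⟩
  rev (suc m +ℕ n) (scale a q) + rev (suc m +ℕ n) (false ∷ p * q)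
    ≈⟨ +-cong (≋-trans (rev-scale (suc m +ℕ n) a q) (≋-trans (scale-cong a (rev-raise (suc m) n q hq)) (≋-sym (constant-* a _))))
              (≋-trans (rev-shift (m +ℕ n) (p * q)) (rev-* p q m n (deg≤-tail hp) hq)) ⟩
  constant a * (X ^ suc m * rev n q) + rev m p * rev n q
    ≈⟨ solve 4 (λ c x r p → c :* (x :* r) :+ p :* r := (x :* c :+ p) :* r) ≋-refl (constant a) (X ^ suc m) (rev n q) (rev m p) ⟩
  (X ^ suc m * constant a + rev m p) * rev n q                 ≈⟨ *-cong (≋-sym rev-horner) ≋-refl ⟩
  rev (suc m) (a ∷ p) * rev n q                                ∎
  where
  deg-constant : Deg≤ (constant a) 0
  deg-constant (suc i) _ = refl
  rev-horner : rev (suc m) (a ∷ p) ≋ X ^ suc m * constant a + rev m p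
  rev-horner = begin
    rev (suc m) (a ∷ p)                              ≈⟨ rev-cong (suc m) (horner a p) ⟩
    rev (suc m) (constant a + X * p)                 ≈⟨ rev-+ (suc m) (constant a) (X * p) ⟩
    rev (suc m) (constant a) + rev (suc m) (X * p)
      ≈⟨ +-cong (subst (λ D → rev D (constant a) ≋ X ^ suc m * rev 0 (constant a)) (ℕₚ.+-identityʳ (suc m))
                       (rev-raise (suc m) 0 (constant a) deg-constant))
                (≋-trans (rev-cong (suc m) (X*-shift p)) (rev-shift m p)) ⟩
    X ^ suc m * rev 0 (constant a) + rev m p         ∎

rev-^ : ∀ p D k → Deg≤ p D → rev (k *ℕ D) (p ^ k) ≋ rev D p ^ k
rev-^ p D zero    h = ≋-refl
rev-^ p D (suc k) h = ≋-trans (rev-* p (p ^ k) D (k *ℕ D) h (deg≤-^ p D k h)) (*-cong (≋-refl {rev D p}) (rev-^ p D k h))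

normalize-≋ : ∀ p → normalize p ≋ p
normalize-≋ []      = ≋-refl
normalize-≋ (a ∷ p) with normalize p | normalize-≋ p
normalize-≋ (true  ∷ p) | []     | p≋[] = ∷-cong refl p≋[]
normalize-≋ (false ∷ p) | []     | p≋[] = ≋-sym (≋-trans (∷-cong refl (≋-sym p≋[])) false∷[]≋[])
normalize-≋ (a ∷ p)     | r ∷ rs | e    = ∷-cong refl e

normalize-zero : ∀ p → p ≋ [] → normalize p ≡ []
normalize-zero []      _ = refl
normalize-zero (a ∷ p) (≈⇒≋ e) with normalize p | normalize-zero p (≈⇒≋ λ i → e (suc i)) | e zero
... | [] | refl | refl = refl

length-normalize : ∀ p D → Deg≤ p D → coeff p D ≡ true → length (normalize p) ≡ suc D
length-normalize (a ∷ p) zero h top with normalize p | normalize-zero p (deg≤0-tail h) | top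
... | [] | refl | refl = refl
length-normalize (a ∷ p) (suc D) h top with normalize p | length-normalize p D (deg≤-tail h) top
... | r ∷ rs | e = cong suc e

rev-snoc : ∀ D x xs → rev (suc D) (x ∷ xs) ≡ rev D xs ∷ʳ x
rev-snoc zero    x xs = refl
rev-snoc (suc D) x xs = cong (coeff xs (suc D) ∷_) (rev-snoc D x xs)

reverse≡rev : ∀ l D → length l ≡ suc D → reverse l ≡ rev D l
reverse≡rev (x ∷ [])     zero    _ = refl
reverse≡rev (x ∷ y ∷ xs) (suc D) e = trans (unfold-reverse x (y ∷ xs))
  (trans (cong (_∷ʳ x) (reverse≡rev (y ∷ xs) D (ℕₚ.suc-injective e))) (sym (rev-snoc D x (y ∷ xs))))

reciprocal≋rev : ∀ p D → Deg≤ p D → coeff p D ≡ true → reciprocal p ≋ rev D p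
reciprocal≋rev p D h top = begin
  reverse (normalize p) ≡⟨ reverse≡rev (normalize p) D (length-normalize p D h top) ⟩
  rev D (normalize p)   ≈⟨ rev-cong D (normalize-≋ p) ⟩
  rev D p               ∎

∂ : Poly → Poly
∂ []      = []
∂ (a ∷ r) = r + (false ∷ ∂ r)

-- Parity of i, as the coefficient (i + 1) mod 2 appearing in derivatives.
isEven : ℕ → Bool
isEven zero    = true
isEven (suc i) = not (isEven i)

coeff-∂ : ∀ p i → coeff (∂ p) i ≡ isEven i ∧ coeff p (suc i)
coeff-∂ []      i       = sym (∧-zeroʳ (isEven i))
coeff-∂ (a ∷ r) zero    = trans (coeff-+ r (false ∷ ∂ r) zero) (xor-identityʳ _)
coeff-∂ (a ∷ r) (suc i) = trans (coeff-+ r (false ∷ ∂ r) (suc i))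
  (trans (cong (coeff r (suc i) xor_) (coeff-∂ r i)) (absorb (coeff r (suc i)) (isEven i)))
  where
  absorb : ∀ x e → x xor (e ∧ x) ≡ not e ∧ x
  absorb x true  = xor-same x
  absorb x false = xor-identityʳ x

∂-cong : ∀ {p q} → p ≋ q → ∂ p ≋ ∂ q
∂-cong {p} {q} (≈⇒≋ e) = ≈⇒≋ λ i → trans (coeff-∂ p i) (trans (cong (isEven i ∧_) (e (suc i))) (sym (coeff-∂ q i)))

∂-+ : ∀ p q → ∂ (p + q) ≋ ∂ p + ∂ q
∂-+ p q = ≈⇒≋ λ i → trans (coeff-∂ (p + q) i) (trans (cong (isEven i ∧_) (coeff-+ p q (suc i)))
  (trans (∧-distribˡ-xor (isEven i) _ _)
  (sym (trans (coeff-+ (∂ p) (∂ q) i) (cong₂ _xor_ (coeff-∂ p i) (coeff-∂ q i))))))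

∂-scale : ∀ a p → ∂ (scale a p) ≋ scale a (∂ p)
∂-scale true  p = ≋-trans (∂-cong (scale-true p)) (≋-sym (scale-true (∂ p)))
∂-scale false p = ≋-trans (∂-cong (scale-false p)) (≋-sym (scale-false (∂ p)))

leibniz : ∀ p q → ∂ (p * q) ≋ ∂ p * q + p * ∂ q
leibniz []      q = ≋-refl
leibniz (a ∷ r) q = begin
  ∂ (scale a q + (false ∷ r * q))                           ≈⟨ ∂-+ (scale a q) (false ∷ r * q) ⟩
  ∂ (scale a q) + (r * q + (false ∷ ∂ (r * q)))             ≈⟨ +-cong (≋-trans (∂-scale a q) (≋-sym (constant-* a (∂ q))))
                                                                 (+-cong (≋-refl {r * q}) (≋-trans (≋-sym (X*-shift (∂ (r * q)))) (*-cong (≋-refl {X}) (leibniz r q)))) ⟩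
  constant a * ∂ q + (r * q + X * (∂ r * q + r * ∂ q))       ≈⟨ solve 6 (λ c x r q dr dq → c :* dq :+ (r :* q :+ x :* (dr :* q :+ r :* dq))
                                                                 := (r :+ x :* dr) :* q :+ (c :+ x :* r) :* dq) ≋-refl (constant a) X r q (∂ r) (∂ q) ⟩
  (r + X * ∂ r) * q + (constant a + X * r) * ∂ q             ≈⟨ +-cong (*-cong (+-cong (≋-refl {r}) (X*-shift (∂ r))) ≋-refl) (*-cong (≋-sym (horner a r)) ≋-refl) ⟩
  ∂ (a ∷ r) * q + (a ∷ r) * ∂ q                              ∎

∂-square : ∀ p → ∂ (p * p) ≋ []
∂-square p = ≋-trans (leibniz p p) (≋-trans (solve 2 (λ p d → d :* p :+ p :* d := con false) ≋-refl p (∂ p)) false∷[]≋[])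

^-double : ∀ p j → p ^ (j *ℕ 2) ≋ p ^ j * p ^ j
^-double p j = ≋-trans (^-* p j 2) (*-cong (≋-refl {p ^ j}) (*-identityʳ (p ^ j)))

∂-^-even : ∀ p j → ∂ (p ^ (j *ℕ 2)) ≋ []
∂-^-even p j = ≋-trans (∂-cong (^-double p j)) (∂-square (p ^ j))

∂-^-odd : ∀ p j → ∂ (p ^ suc (j *ℕ 2)) ≋ ∂ p * p ^ (j *ℕ 2)
∂-^-odd p j = begin
  ∂ (p * p ^ (j *ℕ 2))                            ≈⟨ leibniz p (p ^ (j *ℕ 2)) ⟩
  ∂ p * p ^ (j *ℕ 2) + p * ∂ (p ^ (j *ℕ 2))       ≈⟨ +-cong (≋-refl {∂ p * p ^ (j *ℕ 2)}) (≋-trans (*-cong (≋-refl {p}) (∂-^-even p j)) (*-zeroʳ p)) ⟩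
  ∂ p * p ^ (j *ℕ 2) + []                         ≈⟨ +-identityʳ _ ⟩
  ∂ p * p ^ (j *ℕ 2)                              ∎

-- The field F₄ = F₂(ω) with ω² = ω + 1 (so that Q(ω) = 0), realised on Fin 4.
-- Its identities involve finitely many elements and are checked by enumeration.
F₄ : Set
F₄ = Fin 4

pattern O  = zero
pattern I  = suc zero
pattern ω  = suc (suc zero)
pattern ω² = suc (suc (suc zero))

infixl 6 _⊕_
_⊕_ : F₄ → F₄ → F₄
O  ⊕ y  = y
I  ⊕ O  = I
I  ⊕ I  = O
I  ⊕ ω  = ω²
I  ⊕ ω² = ω
ω  ⊕ O  = ω
ω  ⊕ I  = ω²
ω  ⊕ ω  = O
ω  ⊕ ω² = I
ω² ⊕ O  = ω²
ω² ⊕ I  = ω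
ω² ⊕ ω  = I
ω² ⊕ ω² = O

infixl 7 _⊗_
_⊗_ : F₄ → F₄ → F₄
O  ⊗ y  = O
I  ⊗ y  = y
ω  ⊗ O  = O
ω  ⊗ I  = ω
ω  ⊗ ω  = ω²
ω  ⊗ ω² = I
ω² ⊗ O  = O
ω² ⊗ I  = ω²
ω² ⊗ ω  = I
ω² ⊗ ω² = ω

⊕-identityʳ : ∀ x → x ⊕ O ≡ x
⊕-identityʳ = from-yes (all? λ x → x ⊕ O ≟ᶠ x)

⊗-zeroʳ : ∀ x → x ⊗ O ≡ O
⊗-zeroʳ = from-yes (all? λ x → x ⊗ O ≟ᶠ O)

⊕-interchange : ∀ x y z w → (x ⊕ y) ⊕ (z ⊕ w) ≡ (x ⊕ z) ⊕ (y ⊕ w)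
⊕-interchange = from-yes (all? λ x → all? λ y → all? λ z → all? λ w → (x ⊕ y) ⊕ (z ⊕ w) ≟ᶠ (x ⊕ z) ⊕ (y ⊕ w))

⊗-distribˡ-⊕ : ∀ x y z → x ⊗ (y ⊕ z) ≡ x ⊗ y ⊕ x ⊗ z
⊗-distribˡ-⊕ = from-yes (all? λ x → all? λ y → all? λ z → x ⊗ (y ⊕ z) ≟ᶠ x ⊗ y ⊕ x ⊗ z)

⊗-horner : ∀ x y z w → x ⊗ w ⊕ y ⊗ (z ⊗ w) ≡ (x ⊕ y ⊗ z) ⊗ w
⊗-horner = from-yes (all? λ x → all? λ y → all? λ z → all? λ w → x ⊗ w ⊕ y ⊗ (z ⊗ w) ≟ᶠ (x ⊕ y ⊗ z) ⊗ w)

⊗-no-zero-divisors : ∀ x y → x ⊗ y ≡ O → x ≡ O ⊎ y ≡ O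
⊗-no-zero-divisors = from-yes (all? λ x → all? λ y → (x ⊗ y ≟ᶠ O) →-dec (x ≟ᶠ O ⊎-dec y ≟ᶠ O))

ι : Bool → F₄
ι true  = I
ι false = O

ι-xor : ∀ a b → ι (a xor b) ≡ ι a ⊕ ι b
ι-xor false b     = refl
ι-xor true  true  = refl
ι-xor true  false = refl

ev : F₄ → Poly → F₄
ev α []      = O
ev α (a ∷ p) = ι a ⊕ α ⊗ ev α p

ev-zero : ∀ α {p} → p ≋ [] → ev α p ≡ O
ev-zero α {[]}    _       = refl
ev-zero α {a ∷ p} (≈⇒≋ e) with e zero
... | refl = trans (cong (λ v → α ⊗ v) (ev-zero α {p} (≈⇒≋ λ i → e (suc i)))) (⊗-zeroʳ α)

ev-cong : ∀ α {p q} → p ≋ q → ev α p ≡ ev α q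
ev-cong α {[]}    {q}     e       = sym (ev-zero α (≋-sym e))
ev-cong α {a ∷ p} {[]}    e       = ev-zero α e
ev-cong α {a ∷ p} {b ∷ q} (≈⇒≋ e) = cong₂ (λ c v → ι c ⊕ α ⊗ v) (e zero) (ev-cong α {p} {q} (≈⇒≋ λ i → e (suc i)))

ev-+ : ∀ α p q → ev α (p + q) ≡ ev α p ⊕ ev α q
ev-+ α []      q       = refl
ev-+ α (a ∷ p) []      = sym (⊕-identityʳ _)
ev-+ α (a ∷ p) (b ∷ q) =
  trans (cong₂ (λ c v → c ⊕ α ⊗ v) (ι-xor a b) (ev-+ α p q))
  (trans (cong ((ι a ⊕ ι b) ⊕_) (⊗-distribˡ-⊕ α (ev α p) (ev α q)))
         (⊕-interchange (ι a) (ι b) (α ⊗ ev α p) (α ⊗ ev α q)))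

ev-scale : ∀ α a q → ev α (scale a q) ≡ ι a ⊗ ev α q
ev-scale α true  q = ev-cong α (scale-true q)
ev-scale α false q = ev-cong α (scale-false q)

ev-* : ∀ α p q → ev α (p * q) ≡ ev α p ⊗ ev α q
ev-* α []      q = refl
ev-* α (a ∷ p) q =
  trans (ev-+ α (scale a q) (false ∷ p * q))
  (trans (cong₂ (λ u v → u ⊕ α ⊗ v) (ev-scale α a q) (ev-* α p q))
         (⊗-horner (ι a) α (ev α p) (ev α q)))

ev-one : ∀ α → ev α one ≡ I
ev-one α = cong (I ⊕_) (⊗-zeroʳ α)

Root : F₄ → Poly → Set
Root α p = ev α p ≡ O

nonroot⇒nonzero : ∀ α {p} → ¬ Root α p → ¬ p ≋ []
nonroot⇒nonzero α ¬root p≋[] = ¬root (ev-zero α p≋[])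

root-* : ∀ α {p} q → Root α p → Root α (p * q)
root-* α {p} q root = trans (ev-* α p q) (cong (_⊗ ev α q) root)

root-^ : ∀ α p k → Root α p → Root α (p ^ suc k)
root-^ α p k root = trans (ev-* α p (p ^ k)) (cong (_⊗ ev α (p ^ k)) root)

nonroot-* : ∀ α {p q} → ¬ Root α p → ¬ Root α q → ¬ Root α (p * q)
nonroot-* α {p} {q} ¬rp ¬rq root = [ ¬rp , ¬rq ]′ (⊗-no-zero-divisors (ev α p) (ev α q) (trans (sym (ev-* α p q)) root))

nonroot-^ : ∀ α p k → ¬ Root α p → ¬ Root α (p ^ k)
nonroot-^ α p zero    ¬root root with trans (sym (ev-one α)) root
... | ()
nonroot-^ α p (suc k) ¬root = nonroot-* α {p} {p ^ k} ¬root (nonroot-^ α p k ¬root)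

root-+-nonroot : ∀ α {p q} → Root α p → ¬ Root α q → ¬ Root α (p + q)
root-+-nonroot α {p} {q} rp ¬rq root = ¬rq (trans (cong (_⊕ ev α q) (sym rp)) (trans (sym (ev-+ α p q)) root))

nonroot-+-root : ∀ α {p q} → ¬ Root α p → Root α q → ¬ Root α (p + q)
nonroot-+-root α {p} {q} ¬rp rq root =
  ¬rp (trans (sym (⊕-identityʳ (ev α p))) (trans (cong (ev α p ⊕_) (sym rq)) (trans (sym (ev-+ α p q)) root)))

multiplicity : ∀ α P → Root α P → ¬ P ≋ [] → ∀ f g {U V} → P ^ f * U ≋ P ^ g * V → ¬ Root α U → ¬ Root α V → f ≡ g
multiplicity α P root P≢0 zero    zero    e ¬rU ¬rV = refl
multiplicity α P root P≢0 zero    (suc g) {U} {V} e ¬rU ¬rV =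
  ⊥-elim (¬rU (trans (ev-cong α (≋-trans (≋-sym (*-identityˡ U)) e)) (root-* α {P ^ suc g} V (root-^ α P g root))))
multiplicity α P root P≢0 (suc f) zero    e ¬rU ¬rV = sym (multiplicity α P root P≢0 zero (suc f) (≋-sym e) ¬rV ¬rU)
multiplicity α P root P≢0 (suc f) (suc g) {U} {V} e ¬rU ¬rV = cong suc (multiplicity α P root P≢0 f g
  (*-cancelˡ P {P ^ f * U} {P ^ g * V} P≢0 (≋-trans (≋-sym (*-assoc P (P ^ f) U)) (≋-trans e (*-assoc P (P ^ g) V)))) ¬rU ¬rV)

Y : Poly
Y = X + one

M : ℕ → ℕ → ℕ → Poly
M a b c = X ^ a * Y ^ b * Q ^ c

deg≤-X : Deg≤ X 1
deg≤-X (suc zero)    (s≤s ())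
deg≤-X (suc (suc i)) _ = refl

deg≤-Y : Deg≤ Y 1
deg≤-Y (suc zero)    (s≤s ())
deg≤-Y (suc (suc i)) _ = refl

deg≤-Q : Deg≤ Q 2
deg≤-Q (suc zero)          (s≤s ())
deg≤-Q (suc (suc zero))    (s≤s (s≤s ()))
deg≤-Q (suc (suc (suc i))) _ = refl

rev-X : rev 1 X ≋ one
rev-X = ≈⇒≋ λ { zero → refl ; (suc zero) → refl ; (suc (suc i)) → refl }

rev-Y : rev 1 Y ≋ Y
rev-Y = ≈⇒≋ λ { zero → refl ; (suc zero) → refl ; (suc (suc i)) → refl }

rev-Q : rev 2 Q ≋ Q
rev-Q = ≈⇒≋ λ { zero → refl ; (suc zero) → refl ; (suc (suc zero)) → refl ; (suc (suc (suc i))) → refl }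

∂-Y : ∂ Y ≋ one
∂-Y = ≈⇒≋ λ { zero → refl ; (suc zero) → refl ; (suc (suc i)) → refl }

∂-Q : ∂ Q ≋ one
∂-Q = ≈⇒≋ λ { zero → refl ; (suc zero) → refl ; (suc (suc zero)) → refl ; (suc (suc (suc i))) → refl }

X³+1 : X ^ 3 + one ≋ Y * Q
X³+1 = ≈⇒≋ λ { zero → refl ; (suc zero) → refl ; (suc (suc zero)) → refl ; (suc (suc (suc zero))) → refl
             ; (suc (suc (suc (suc zero)))) → refl ; (suc (suc (suc (suc (suc i))))) → refl }

degM : ℕ → ℕ → ℕ → ℕ
degM a b c = a *ℕ 1 +ℕ b *ℕ 1 +ℕ c *ℕ 2

deg≤-XᵃYᵇ : ∀ a b → Deg≤ (X ^ a * Y ^ b) (a *ℕ 1 +ℕ b *ℕ 1)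
deg≤-XᵃYᵇ a b = deg≤-* (X ^ a) (Y ^ b) (a *ℕ 1) (b *ℕ 1) (deg≤-^ X 1 a deg≤-X) (deg≤-^ Y 1 b deg≤-Y)

deg≤-M : ∀ a b c → Deg≤ (M a b c) (degM a b c)
deg≤-M a b c = deg≤-* (X ^ a * Y ^ b) (Q ^ c) _ (c *ℕ 2) (deg≤-XᵃYᵇ a b) (deg≤-^ Q 2 c deg≤-Q)

coeff-top-M : ∀ a b c → coeff (M a b c) (degM a b c) ≡ true
coeff-top-M a b c = trans (coeff-top-* (X ^ a * Y ^ b) (Q ^ c) _ (c *ℕ 2) (deg≤-XᵃYᵇ a b) (deg≤-^ Q 2 c deg≤-Q))
  (cong₂ _∧_ (trans (coeff-top-* (X ^ a) (Y ^ b) (a *ℕ 1) (b *ℕ 1) (deg≤-^ X 1 a deg≤-X) (deg≤-^ Y 1 b deg≤-Y))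
                    (cong₂ _∧_ (coeff-top-^ X 1 a deg≤-X refl) (coeff-top-^ Y 1 b deg≤-Y refl)))
             (coeff-top-^ Q 2 c deg≤-Q refl))

rev-M : ∀ a b c → rev (degM a b c) (M a b c) ≋ Y ^ b * Q ^ c
rev-M a b c = begin
  rev (degM a b c) (M a b c)
    ≈⟨ rev-* (X ^ a * Y ^ b) (Q ^ c) _ (c *ℕ 2) (deg≤-XᵃYᵇ a b) (deg≤-^ Q 2 c deg≤-Q) ⟩
  rev (a *ℕ 1 +ℕ b *ℕ 1) (X ^ a * Y ^ b) * rev (c *ℕ 2) (Q ^ c)
    ≈⟨ *-cong (rev-* (X ^ a) (Y ^ b) (a *ℕ 1) (b *ℕ 1) (deg≤-^ X 1 a deg≤-X) (deg≤-^ Y 1 b deg≤-Y)) (rev-^ Q 2 c deg≤-Q) ⟩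
  rev (a *ℕ 1) (X ^ a) * rev (b *ℕ 1) (Y ^ b) * rev 2 Q ^ c
    ≈⟨ *-cong (*-cong (≋-trans (rev-^ X 1 a deg≤-X) (≋-trans (^-cong a rev-X) (one-^ a))) (≋-trans (rev-^ Y 1 b deg≤-Y) (^-cong b rev-Y)))
              (^-cong c rev-Q) ⟩
  one * Y ^ b * Q ^ c
    ≈⟨ *-cong (*-identityˡ (Y ^ b)) (≋-refl {Q ^ c}) ⟩
  Y ^ b * Q ^ c ∎

reciprocal-Qabc : ∀ a b c → 1 ≤ a → reciprocal (Qabc a b c) ≋ X ^ (a +ℕ b +ℕ 2 *ℕ c) + Y ^ b * Q ^ c
reciprocal-Qabc a@(suc _) b c _ = subst (λ N → reciprocal (Qabc a b c) ≋ X ^ N + Y ^ b * Q ^ c) degM≡ (begin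
  reciprocal (Qabc a b c)      ≈⟨ reciprocal≋rev (Qabc a b c) N deg≤-Qabc top ⟩
  rev N (one + M a b c)        ≈⟨ rev-+ N one (M a b c) ⟩
  rev N one + rev N (M a b c)  ≈⟨ +-cong (subst (λ D → rev D one ≋ X ^ N * one) (ℕₚ.+-identityʳ N) (rev-raise N 0 one deg≤-one)) (rev-M a b c) ⟩
  X ^ N * one + Y ^ b * Q ^ c  ≈⟨ +-cong (*-identityʳ (X ^ N)) (≋-refl {Y ^ b * Q ^ c}) ⟩
  X ^ N + Y ^ b * Q ^ c        ∎)
  where
  N : ℕ
  N = degM a b c
  degM≡ : N ≡ a +ℕ b +ℕ 2 *ℕ c
  degM≡ = cong₂ _+ℕ_ (cong₂ _+ℕ_ (ℕₚ.*-identityʳ a) (ℕₚ.*-identityʳ b)) (ℕₚ.*-comm c 2)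
  deg≤-Qabc : Deg≤ (Qabc a b c) N
  deg≤-Qabc i N<i = trans (coeff-+ one (M a b c) i) (cong₂ _xor_ (deg≤-one i (ℕₚ.≤-<-trans z≤n N<i)) (deg≤-M a b c i N<i))
  top : coeff (Qabc a b c) N ≡ true
  top = trans (coeff-+ one (M a b c) N) (cong (false xor_) (coeff-top-M a b c))

X^[3·2ⁿ]+1 : ∀ n → X ^ (3 *ℕ 2 ^ℕ n) + one ≋ Y ^ (2 ^ℕ n) * Q ^ (2 ^ℕ n)
X^[3·2ⁿ]+1 n = begin
  X ^ (3 *ℕ t) + one        ≈⟨ +-cong (^-* X 3 t) (≋-sym (one-^ t)) ⟩
  (X ^ 3) ^ t + one ^ t     ≈⟨ ≋-sym (frobenius (X ^ 3) one n) ⟩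
  (X ^ 3 + one) ^ t         ≈⟨ ^-cong t X³+1 ⟩
  (Y * Q) ^ t               ≈⟨ *-^ Y Q t ⟩
  Y ^ t * Q ^ t             ∎
  where
  t : ℕ
  t = 2 ^ℕ n

factorisation : ∀ {b c d e f t k m} → Qabc d e f ≋ X ^ (3 *ℕ t) + Y ^ b * Q ^ c
  → X ^ (3 *ℕ t) + one ≋ Y ^ t * Q ^ t → b ≡ t +ℕ k → t ≡ c +ℕ m
  → M d e f ≋ Y ^ t * Q ^ c * (Q ^ m + Y ^ k)
factorisation {b} {c} {d} {e} {f} {t} {k} {m} reciprocal≋ X³ᵗ+1 refl refl = begin
  M d e f                                     ≈⟨ solve 1 (λ x → x := con true :+ (con true :+ x)) ≋-refl (M d e f) ⟩
  one + Qabc d e f                            ≈⟨ +-cong (≋-refl {one}) reciprocal≋ ⟩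
  one + (X ^ (3 *ℕ t) + Y ^ b * Q ^ c)        ≈⟨ solve 2 (λ x y → con true :+ (x :+ y) := (x :+ con true) :+ y) ≋-refl (X ^ (3 *ℕ t)) (Y ^ b * Q ^ c) ⟩
  (X ^ (3 *ℕ t) + one) + Y ^ b * Q ^ c        ≈⟨ +-cong X³ᵗ+1 (*-cong (^-+ Y t k) (≋-refl {Q ^ c})) ⟩
  Y ^ t * Q ^ (c +ℕ m) + Y ^ t * Y ^ k * Q ^ c ≈⟨ +-cong (*-cong (≋-refl {Y ^ t}) (^-+ Q c m)) (≋-refl {Y ^ t * Y ^ k * Q ^ c}) ⟩
  Y ^ t * (Q ^ c * Q ^ m) + Y ^ t * Y ^ k * Q ^ c
    ≈⟨ solve 4 (λ y q qm yk → y :* (q :* qm) :+ y :* yk :* q := y :* q :* (qm :+ yk)) ≋-refl (Y ^ t) (Q ^ c) (Q ^ m) (Y ^ k) ⟩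
  Y ^ t * Q ^ c * (Q ^ m + Y ^ k)             ∎

Y≢0 : ¬ Y ≋ []
Y≢0 = nonroot⇒nonzero O (λ ())

Q≢0 : ¬ Q ≋ []
Q≢0 = nonroot⇒nonzero O (λ ())

compare-factors : ∀ {d e f t c k m} → 1 ≤ k → 1 ≤ m → M d e f ≋ Y ^ t * Q ^ c * (Q ^ m + Y ^ k)
  → e ≡ t × f ≡ c × X ^ d ≋ Q ^ m + Y ^ k
compare-factors {d} {e} {f} {t} {c} {suc k} {suc m} _ _ eq = e≡t , f≡c , X^d≋R
  where
  R : Poly
  R = Q ^ suc m + Y ^ suc k
  Y-part : Y ^ e * (X ^ d * Q ^ f) ≋ Y ^ t * (Q ^ c * R)
  Y-part = ≋-trans (solve 3 (λ x y q → y :* (x :* q) := x :* y :* q) ≋-refl (X ^ d) (Y ^ e) (Q ^ f))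
                   (≋-trans eq (*-assoc (Y ^ t) (Q ^ c) R))
  e≡t : e ≡ t
  e≡t = multiplicity I Y refl Y≢0 e t Y-part
    (nonroot-* I {X ^ d} (nonroot-^ I X d (λ ())) (nonroot-^ I Q f (λ ())))
    (nonroot-* I {Q ^ c} (nonroot-^ I Q c (λ ())) (nonroot-+-root I {Q ^ suc m} (nonroot-^ I Q (suc m) (λ ())) (root-^ I Y k refl)))
  Q-part : Q ^ f * (X ^ d * Y ^ e) ≋ Q ^ c * (Y ^ t * R)
  Q-part = ≋-trans (solve 3 (λ x y q → q :* (x :* y) := x :* y :* q) ≋-refl (X ^ d) (Y ^ e) (Q ^ f))
                   (≋-trans eq (solve 3 (λ y q r → y :* q :* r := q :* (y :* r)) ≋-refl (Y ^ t) (Q ^ c) R))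
  f≡c : f ≡ c
  f≡c = multiplicity ω Q refl Q≢0 f c Q-part
    (nonroot-* ω {X ^ d} (nonroot-^ ω X d (λ ())) (nonroot-^ ω Y e (λ ())))
    (nonroot-* ω {Y ^ t} (nonroot-^ ω Y t (λ ())) (root-+-nonroot ω {Q ^ suc m} (root-^ ω Q m refl) (nonroot-^ ω Y (suc k) (λ ()))))
  X^d≋R : X ^ d ≋ R
  X^d≋R = *-cancelˡ (Y ^ t * Q ^ c) (nonroot⇒nonzero O (nonroot-* O {Y ^ t} (nonroot-^ O Y t (λ ())) (nonroot-^ O Q c (λ ()))))
    (≋-trans (solve 3 (λ x y q → y :* q :* x := x :* y :* q) ≋-refl (X ^ d) (Y ^ t) (Q ^ c))
             (subst₂ (λ e f → X ^ d * Y ^ e * Q ^ f ≋ Y ^ t * Q ^ c * R) e≡t f≡c eq))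

degree-comparison : ∀ {d m k} → X ^ d ≋ Q ^ m + Y ^ k → k < m *ℕ 2 → d ≡ m *ℕ 2
degree-comparison {d} {m} {k} (≈⇒≋ eq) k<2m with ℕₚ.<-cmp d (m *ℕ 2)
... | tri≈ _ d≡2m _ = d≡2m
... | tri< d<2m _ _ = contradiction (trans (sym (X^d-above (m *ℕ 2) d<2m)) (trans (eq (m *ℕ 2)) R-top)) λ ()
  where
  R-top : coeff (Q ^ m + Y ^ k) (m *ℕ 2) ≡ true
  R-top = trans (coeff-+ (Q ^ m) (Y ^ k) (m *ℕ 2))
    (cong₂ _xor_ (coeff-top-^ Q 2 m deg≤-Q refl) (deg≤-^ Y 1 k deg≤-Y (m *ℕ 2) (subst (_< m *ℕ 2) (sym (ℕₚ.*-identityʳ k)) k<2m)))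
  X^d-above : ∀ i → d < i → coeff (X ^ d) i ≡ false
  X^d-above i d<i = deg≤-^ X 1 d deg≤-X i (subst (_< i) (sym (ℕₚ.*-identityʳ d)) d<i)
... | tri> _ _ 2m<d = contradiction (trans (sym X^d-top) (trans (eq d) R-above)) λ ()
  where
  X^d-top : coeff (X ^ d) d ≡ true
  X^d-top = subst (λ i → coeff (X ^ d) i ≡ true) (ℕₚ.*-identityʳ d) (coeff-top-^ X 1 d deg≤-X refl)
  R-above : coeff (Q ^ m + Y ^ k) d ≡ false
  R-above = trans (coeff-+ (Q ^ m) (Y ^ k) d)
    (cong₂ _xor_ (deg≤-^ Q 2 m deg≤-Q d 2m<d) (deg≤-^ Y 1 k deg≤-Y d (subst (_< d) (sym (ℕₚ.*-identityʳ k)) (ℕₚ.<-trans k<2m 2m<d))))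

even-or-odd : ∀ n → 2 ∣ n ⊎ ∃[ j ] n ≡ suc (j *ℕ 2)
even-or-odd zero    = inj₁ (divides 0 refl)
even-or-odd (suc n) with even-or-odd n
... | inj₁ (divides j refl) = inj₂ (j , refl)
... | inj₂ (j , refl)       = inj₁ (divides (suc j) refl)

∂-^-odd-unit : ∀ p j → ∂ p ≋ one → ∂ (p ^ suc (j *ℕ 2)) ≋ p ^ (j *ℕ 2)
∂-^-odd-unit p j ∂p≋1 = ≋-trans (∂-^-odd p j) (≋-trans (*-cong ∂p≋1 (≋-refl {p ^ (j *ℕ 2)})) (*-identityˡ _))

-- Q^u = (x+1)^v only for u = v = 0, since Q^u vanishes at ω for u > 0 and
-- (x+1)^v vanishes at 1 for v > 0.
Q^u≋Y^v : ∀ u v → Q ^ u ≋ Y ^ v → u ≡ 0 × v ≡ 0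
Q^u≋Y^v zero    zero    _ = refl , refl
Q^u≋Y^v (suc u) v       e = ⊥-elim (nonroot-^ ω Y v (λ ()) (trans (sym (ev-cong ω e)) (root-^ ω Q u refl)))
Q^u≋Y^v zero    (suc v) e = ⊥-elim (nonroot-^ I Q 0 (λ ()) (trans (ev-cong I e) (root-^ I Y v refl)))

equal-derivatives : ∀ m k → ∂ (Q ^ m) ≋ ∂ (Y ^ k) → (m ≡ 1 × k ≡ 1) ⊎ (2 ∣ m × 2 ∣ k)
equal-derivatives m k e with even-or-odd m | even-or-odd k
... | inj₁ 2∣m              | inj₁ 2∣k              = inj₂ (2∣m , 2∣k)
... | inj₂ (j , refl)       | inj₁ (divides i refl) =
  ⊥-elim (nonroot-^ O Q (j *ℕ 2) (λ ()) (ev-zero O (≋-trans (≋-sym (∂-^-odd-unit Q j ∂-Q)) (≋-trans e (∂-^-even Y i)))))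
... | inj₁ (divides j refl) | inj₂ (i , refl)       =
  ⊥-elim (nonroot-^ O Y (i *ℕ 2) (λ ()) (ev-zero O (≋-trans (≋-sym (∂-^-odd-unit Y i ∂-Y)) (≋-trans (≋-sym e) (∂-^-even Q j)))))
... | inj₂ (j , refl)       | inj₂ (i , refl)       =
  let (j*2≡0 , i*2≡0) = Q^u≋Y^v (j *ℕ 2) (i *ℕ 2) (≋-trans (≋-sym (∂-^-odd-unit Q j ∂-Q)) (≋-trans e (∂-^-odd-unit Y i ∂-Y)))
  in inj₁ (cong suc j*2≡0 , cong suc i*2≡0)

-- Differentiating x^{2m} = Q^m + (x+1)^k kills the left-hand side.
derivative-comparison : ∀ {m k} → X ^ (m *ℕ 2) ≋ Q ^ m + Y ^ k → (m ≡ 1 × k ≡ 1) ⊎ (2 ∣ m × 2 ∣ k)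
derivative-comparison {m} {k} eq =
  equal-derivatives m k (+≋[]⇒≋ (≋-trans (≋-sym (∂-+ (Q ^ m) (Y ^ k))) (≋-trans (∂-cong (≋-sym eq)) (∂-^-even X m))))

-- An irreducible polynomial is not a square, since a square of a non-unit is
-- reducible and a square of a unit is a unit.
irreducible⇒not-square : ∀ {p} g → Irreducible p → ¬ p ≋ g * g
irreducible⇒not-square {p} g irr p≋g² =
  Irreducible.nonunit irr ([ unit² , unit² ]′ (Irreducible.factors irr g g (≋⇒≈ p≋g²)))
  where
  unit² : IsUnit g → IsUnit p
  unit² (v , gv≈1) = v * v , ≋⇒≈ (begin
    p * (v * v)           ≈⟨ *-cong p≋g² (≋-refl {v * v}) ⟩
    g * g * (v * v)       ≈⟨ solve 2 (λ g v → g :* g :* (v :* v) := g :* v :* (g :* v)) ≋-refl g v ⟩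
    g * v * (g * v)       ≈⟨ *-cong gv≋1 gv≋1 ⟩
    one * one             ≈⟨ *-identityˡ one ⟩
    one                   ∎)
    where
    gv≋1 : g * v ≋ one
    gv≋1 = ≈⇒≋ gv≈1

Qabc-square : ∀ a b c → Qabc (a *ℕ 2) (b *ℕ 2) (c *ℕ 2) ≋ Qabc a b c * Qabc a b c
Qabc-square a b c = begin
  one + X ^ (a *ℕ 2) * Y ^ (b *ℕ 2) * Q ^ (c *ℕ 2)
    ≈⟨ +-cong (≋-refl {one}) (*-cong (*-cong (^-double X a) (^-double Y b)) (^-double Q c)) ⟩
  one + X ^ a * X ^ a * (Y ^ b * Y ^ b) * (Q ^ c * Q ^ c)
    ≈⟨ solve 3 (λ x y q → con true :+ x :* x :* (y :* y) :* (q :* q) := (con true :+ x :* y :* q) :* (con true :+ x :* y :* q))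
             ≋-refl (X ^ a) (Y ^ b) (Q ^ c) ⟩
  Qabc a b c * Qabc a b c ∎

even-exponents-reducible : ∀ {a b c} → Irreducible (Qabc a b c) → 2 ∣ a × 2 ∣ b × 2 ∣ c → ⊥
even-exponents-reducible irr (divides i refl , divides j refl , divides l refl) =
  irreducible⇒not-square (Qabc i j l) irr (Qabc-square i j l)

halve : ∀ {a k c t} → a +ℕ suc k +ℕ 2 *ℕ c ≡ 2 *ℕ t → ∃[ m ] (t ≡ c +ℕ suc m × a +ℕ suc k ≡ suc m *ℕ 2)
halve {a} {k} {c} {t} h with ℕₚ.m≤n⇒∃[o]m+o≡n c<t
  where
  c<t : c < t
  c<t = ℕₚ.*-cancelˡ-< 2 c t (subst (2 *ℕ c <_) h (ℕₚ.m<n+m (2 *ℕ c) (subst (0 <_) (sym (ℕₚ.+-suc a k)) (s≤s z≤n))))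
... | m , refl = m , sym (ℕₚ.+-suc c m) , ℕₚ.+-cancelʳ-≡ (2 *ℕ c) _ _ (trans h (double c m))
  where
  double : ∀ c m → 2 *ℕ (suc c +ℕ m) ≡ suc m *ℕ 2 +ℕ 2 *ℕ c
  double = solve-∀

exponent-split : ∀ {a b c t} → a +ℕ b +ℕ 2 *ℕ c ≡ 3 *ℕ t → t < b
  → ∃[ k ] ∃[ m ] (b ≡ t +ℕ suc k × t ≡ c +ℕ suc m × a +ℕ suc k ≡ suc m *ℕ 2)
exponent-split {a} {b} {c} {t} sum t<b with ℕₚ.m≤n⇒∃[o]m+o≡n t<b
... | k , refl = k , proj₁ halved , sym (ℕₚ.+-suc t k) , proj₂ halved
  where
  shuffle : ∀ a t k c → t +ℕ (a +ℕ suc k +ℕ 2 *ℕ c) ≡ a +ℕ (suc t +ℕ k) +ℕ 2 *ℕ c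
  shuffle = solve-∀
  triple : ∀ t → 3 *ℕ t ≡ t +ℕ 2 *ℕ t
  triple = solve-∀
  halved : ∃[ m ] (t ≡ c +ℕ suc m × a +ℕ suc k ≡ suc m *ℕ 2)
  halved = halve (ℕₚ.+-cancelˡ-≡ t _ _ (trans (shuffle a t k c) (trans sum (triple t))))

even-exponents : ∀ {a b c t k m} → a +ℕ k ≡ m *ℕ 2 → b ≡ t +ℕ k → t ≡ c +ℕ m
  → 2 ∣ t → 2 ∣ m → 2 ∣ k → 2 ∣ a × 2 ∣ b × 2 ∣ c
even-exponents {a} {b} {c} {t} {k} {m} a+k≡2m b≡t+k t≡c+m 2∣t 2∣m 2∣k =
    ∣m+n∣m⇒∣n (subst (2 ∣_) (trans (sym a+k≡2m) (ℕₚ.+-comm a k)) (n∣m*n m)) 2∣k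
  , subst (2 ∣_) (sym b≡t+k) (∣m∣n⇒∣m+n 2∣t 2∣k)
  , ∣m+n∣m⇒∣n (subst (2 ∣_) (trans t≡c+m (ℕₚ.+-comm c m)) 2∣t) 2∣m

2∣2^n : ∀ n → 2 ≤ 2 ^ℕ n → 2 ∣ 2 ^ℕ n
2∣2^n zero    (s≤s ())
2∣2^n (suc n) _ = divides (2 ^ℕ n) (ℕₚ.*-comm 2 (2 ^ℕ n))

exponents-when-k=m=1 : ∀ {a c t} → a +ℕ 1 ≡ 2 → t ≡ c +ℕ 1 → a ≡ 1 × c ≡ t ∸ℕ 1
exponents-when-k=m=1 {a} {c} a+1≡2 t≡c+1 = ℕₚ.+-cancelʳ-≡ 1 a 1 a+1≡2 , sym (trans (cong (_∸ℕ 1) t≡c+1) (ℕₚ.m+n∸n≡m c 1))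

reciprocal-factorisation : ∀ {a b c d e f n k m} → 1 ≤ a → reciprocal (Qabc a b c) ≈ Qabc d e f
  → a +ℕ b +ℕ 2 *ℕ c ≡ 3 *ℕ 2 ^ℕ n → b ≡ 2 ^ℕ n +ℕ k → 2 ^ℕ n ≡ c +ℕ m
  → M d e f ≋ Y ^ (2 ^ℕ n) * Q ^ c * (Q ^ m + Y ^ k)
reciprocal-factorisation {a} {b} {c} {d} {e} {f} {n} {k} {m} 1≤a reciprocal≈ sum b≡t+k t≡c+m =
  factorisation {b} {c} {d} {e} {f} {2 ^ℕ n} {k} {m} Qᵈᵉᶠ≋ (X^[3·2ⁿ]+1 n) b≡t+k t≡c+m
  where
  Qᵈᵉᶠ≋ : Qabc d e f ≋ X ^ (3 *ℕ 2 ^ℕ n) + Y ^ b * Q ^ c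
  Qᵈᵉᶠ≋ = begin
    Qabc d e f                                ≈⟨ ≋-sym (≈⇒≋ reciprocal≈) ⟩
    reciprocal (Qabc a b c)                   ≈⟨ reciprocal-Qabc a b c 1≤a ⟩
    X ^ (a +ℕ b +ℕ 2 *ℕ c) + Y ^ b * Q ^ c    ≡⟨ cong (λ N → X ^ N + Y ^ b * Q ^ c) sum ⟩
    X ^ (3 *ℕ 2 ^ℕ n) + Y ^ b * Q ^ c         ∎

lemma3p20 : (a b c d e f n : ℕ) → 1 ≤ a → 1 ≤ b → 1 ≤ c → 1 ≤ d → 1 ≤ e → 1 ≤ f
    → Irreducible (Qabc a b c)
    → reciprocal (Qabc a b c) ≈ Qabc d e f
    → ¬ (Qabc d e f ≈ Qabc a b c)
    → a +ℕ b +ℕ 2 *ℕ c ≡ 3 *ℕ 2 ^ℕ n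
    → 2 ^ℕ n < b
    → a ≡ 1 × e ≡ 2 ^ℕ n × b ≡ 2 ^ℕ n +ℕ 1 × f ≡ 2 ^ℕ n ∸ℕ 1 × c ≡ 2 ^ℕ n ∸ℕ 1 × d ≡ 2
lemma3p20 a b c d e f n 1≤a _ 1≤c _ _ _ irr reciprocal≈ _ sum t<b with exponent-split sum t<b
... | k , m , b≡t+k , t≡c+m , a+k≡2m = [ case-k=m=1 , case-even ]′ (derivative-comparison x²ᵐ≋)
  where
  factors : e ≡ 2 ^ℕ n × f ≡ c × X ^ d ≋ Q ^ suc m + Y ^ suc k
  factors = compare-factors {d} {e} {f} {2 ^ℕ n} {c} {suc k} {suc m} (s≤s z≤n) (s≤s z≤n)
    (reciprocal-factorisation {a} {b} {c} {d} {e} {f} {n} {suc k} {suc m} 1≤a reciprocal≈ sum b≡t+k t≡c+m)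
  d≡2m : d ≡ suc m *ℕ 2
  d≡2m = degree-comparison {d} {suc m} {suc k} (proj₂ (proj₂ factors)) (subst (suc k <_) a+k≡2m (ℕₚ.m<n+m (suc k) 1≤a))
  x²ᵐ≋ : X ^ (suc m *ℕ 2) ≋ Q ^ suc m + Y ^ suc k
  x²ᵐ≋ = subst (λ d → X ^ d ≋ Q ^ suc m + Y ^ suc k) d≡2m (proj₂ (proj₂ factors))
  case-even : 2 ∣ suc m × 2 ∣ suc k → a ≡ 1 × e ≡ 2 ^ℕ n × b ≡ 2 ^ℕ n +ℕ 1 × f ≡ 2 ^ℕ n ∸ℕ 1 × c ≡ 2 ^ℕ n ∸ℕ 1 × d ≡ 2
  case-even (2∣m , 2∣k) = ⊥-elim (even-exponents-reducible irr (even-exponents a+k≡2m b≡t+k t≡c+m 2∣t 2∣m 2∣k))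
    where
    2∣t : 2 ∣ 2 ^ℕ n
    2∣t = 2∣2^n n (subst (2 ≤_) (sym t≡c+m) (ℕₚ.+-mono-≤ 1≤c (s≤s z≤n)))
  case-k=m=1 : suc m ≡ 1 × suc k ≡ 1 → a ≡ 1 × e ≡ 2 ^ℕ n × b ≡ 2 ^ℕ n +ℕ 1 × f ≡ 2 ^ℕ n ∸ℕ 1 × c ≡ 2 ^ℕ n ∸ℕ 1 × d ≡ 2
  case-k=m=1 (refl , refl) = let (a≡1 , c≡t∸1) = exponents-when-k=m=1 a+k≡2m t≡c+m in
    a≡1 , proj₁ factors , b≡t+k , trans (proj₁ (proj₂ factors)) c≡t∸1 , c≡t∸1 , d≡2m
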